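{- Let $\mathcal{P}$ be an LR-vine, and let $\widehat{\mathcal{P}}=\{U_a\mid a\in\mathcal{P}\}$ be the poset of complete unions of elements of $\mathcal{P}$, partially ordered by set inclusion. Then the map $\eta_{\mathcal{P}}\colon\mathcal{P}\to\widehat{\mathcal{P}}$, $a\mapsto U_a$, is a poset isomorphism; in particular $\mathcal{P}\simeq\widehat{\mathcal{P}}$.
   Context: Posets are finite. A graded poset has a rank function $\operatorname{rk}\colon\mathcal{P}\to\mathbb{Z}_{>0}$ with $x<y\Rightarrow\operatorname{rk}(x)<\operatorname{rk}(y)$, $\operatorname{rk}(y)=\operatorname{rk}(x)+1$ when $y$ covers $x$, and minimal elements of rank $1$; $\mathcal{P}_i$ = elements of rank $i$, $\dim(\mathcal{P})$ = number of minimal elements, $\mathcal{E}(v)$ = elements covered by $v$. A vine is a graded poset in which every non-minimal element covers exactly two elements, any two distinct elements of the same rank are covered by at most one common element, and for each $1\le i\le\operatorname{rk}(\mathcal{P})$ the graph $F_i$ on $\mathcal{P}_i$ with edge set $\{\mathcal{E}(v)\mid v\in\mathcal{P}_{i+1}\}$ is a forest. An R-vine is a vine with $\operatorname{rk}(\mathcal{P})=\dim(\mathcal{P})$, each $F_i$ a tree, and proximity: distinct elements of the same rank $i\ge2$ covered by a common element cover a common element. An LR-vine is a vine all of whose principal ideals $\mathcal{P}_{\le v}$ (induced order and rank) are R-vines. The complete union of $a\in\mathcal{P}$ is $U_a=\{x\in\mathcal{P}\mid x\text{ minimal},\ x\le a\}$. A poset isomorphism is a bijective order-preserving map whose inverse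 is order-preserving. -}

module Defs where

open import Level using (0ℓ) renaming (suc to lsuc)
open import Data.Nat using (ℕ; zero; suc; _≤_; _<_; _≥_)
open import Data.Fin using (Fin)
open import Data.Product using (Σ; ∃; _×_; _,_; proj₁; proj₂)
open import Data.Sum using (_⊎_)
open import Data.Unit using (⊤)
open import Data.Empty using (⊥)
open import Data.List using (List; []; _∷_; _++_; length)
open import Data.List.Relation.Unary.Linked using (Linked)
open import Data.List.Relation.Unary.Unique.Propositional using (Unique)
open import Function.Definitions using (Injective)
open import Relation.Nullary using (¬_)
open import Relation.Unary using (Pred; _⊆_; _≐_)
open import Relation.Binary using (Rel; IsPartialOrder; IsPreorder; IsEquivalence)
open import Relation.Binary.Bundles using (Poset)
open import Relation.Binary.PropositionalEquality using (_≡_; _≢_; refl; isEquivalence)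
open import Relation.Binary.Morphism.Structures using (IsOrderIsomorphism)

record FinPoset : Set₁ where
  field
    n              : ℕ
    _≼_            : Rel (Fin n) 0ℓ
    isPartialOrder : IsPartialOrder _≡_ _≼_

  Elt : Set
  Elt = Fin n

  _≺_ : Rel Elt 0ℓ
  x ≺ y = x ≼ y × x ≢ y

  poset : Poset 0ℓ 0ℓ 0ℓ
  poset = record { Carrier = Elt ; _≈_ = _≡_ ; _≤_ = _≼_ ; isPartialOrder = isPartialOrder }

-- Everything below is relative to a subset S of the carrier, equipped
-- with the induced order and the induced (restricted) rank function
-- rk.  The whole poset is S = Full; a principal ideal P_{≤v} is
-- S = (_≼ v).

module _ (P : FinPoset) where
  open FinPoset P

  Full : Pred Elt 0ℓ
  Full _ = ⊤

  Ideal : Elt → Pred Elt 0ℓ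
  Ideal v x = x ≼ v

  module Sub (S : Pred Elt 0ℓ) (rk : Elt → ℕ) where

    Minimal : Elt → Set
    Minimal x = S x × (∀ y → S y → y ≼ x → y ≡ x)

    Covers : Elt → Elt → Set
    Covers y x = S x × S y × x ≺ y × (∀ z → S z → x ≺ z → ¬ (z ≺ y))

    IsGraded : Set
    IsGraded =
        (∀ x → S x → 1 ≤ rk x)
      × (∀ x y → S x → S y → x ≺ y → rk x < rk y)
      × (∀ x y → Covers y x → rk y ≡ suc (rk x))
      × (∀ x → Minimal x → rk x ≡ 1)

    RankIs : ℕ → Set
    RankIs m = (∀ x → S x → rk x ≤ m) × (m ≡ 0 ⊎ Σ Elt λ x → S x × rk x ≡ m)

    DimIs : ℕ → Set
    DimIs k = Σ (Fin k → Elt) λ f →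
        Injective _≡_ _≡_ f
      × (∀ j → Minimal (f j))
      × (∀ x → Minimal x → Σ (Fin k) λ j → f j ≡ x)

    CoversExactly : Elt → Elt → Elt → Set
    CoversExactly v x y =
      x ≢ y × Covers v x × Covers v y × (∀ c → Covers v c → c ≡ x ⊎ c ≡ y)

    Vertex : ℕ → Elt → Set
    Vertex i x = S x × rk x ≡ i

    Adj : ℕ → Rel Elt 0ℓ
    Adj i x y = Vertex i x × Vertex i y ×
      (Σ Elt λ v → S v × rk v ≡ suc i × CoversExactly v x y)

    HasCycle : ℕ → Set
    HasCycle i = Σ Elt λ x → Σ (List Elt) λ ys →
        2 ≤ length ys
      × Unique (x ∷ ys)
      × Linked (Adj i) (x ∷ ys ++ x ∷ [])

    IsForest : ℕ → Set
    IsForest i = ¬ HasCycle i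

    IsConnected : ℕ → Set
    IsConnected i = ∀ x y → Vertex i x → Vertex i y →
      x ≡ y ⊎ (Σ (List Elt) λ zs → Linked (Adj i) (x ∷ zs ++ y ∷ []))

    IsTree : ℕ → Set
    IsTree i = IsForest i × IsConnected i

    IsVine : Set
    IsVine =
        IsGraded
      × (∀ v → S v → ¬ Minimal v → Σ Elt λ x → Σ Elt λ y → CoversExactly v x y)
      × (∀ x y v w → x ≢ y → rk x ≡ rk y →
           Covers v x → Covers v y → Covers w x → Covers w y → v ≡ w)
        -- each F_i (1 ≤ i ≤ rk) is a forest (vacuous for other i)
      × (∀ i → IsForest i)

    IsRVine : Set
    IsRVine =
        IsVine
      × (Σ ℕ λ m → RankIs m × DimIs m
           × (∀ i → 1 ≤ i → i ≤ m → IsTree i))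
      × (∀ x y v → x ≢ y → rk x ≡ rk y → 2 ≤ rk x →
           Covers v x → Covers v y →
           Σ Elt λ z → Covers x z × Covers y z)

  IsLRVine : (Elt → ℕ) → Set
  IsLRVine rk = Sub.IsVine Full rk × (∀ v → Sub.IsRVine (Ideal v) rk)

  U : (Elt → ℕ) → Elt → Pred Elt 0ℓ
  U rk a x = Sub.Minimal Full rk x × x ≼ a

  -- the poset P̂ of complete unions, ordered by inclusion; sets are
  -- predicates compared extensionally (_≐_)
  module Hat (rk : Elt → ℕ) where

    Carrierˆ : Set₁
    Carrierˆ = Σ (Pred Elt 0ℓ) λ V → Σ Elt λ a → V ≐ U rk a

    _≈ˆ_ : Rel Carrierˆ 0ℓ
    A ≈ˆ B = proj₁ A ≐ proj₁ B

    _⊆ˆ_ : Rel Carrierˆ 0ℓ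
    A ⊆ˆ B = proj₁ A ⊆ proj₁ B

    isPartialOrderˆ : IsPartialOrder _≈ˆ_ _⊆ˆ_
    isPartialOrderˆ = record
      { isPreorder = record
        { isEquivalence = record
          { refl = (λ z → z) , (λ z → z)
          ; sym = λ (p , q) → q , p
          ; trans = λ (p , q) (r , s) → (λ z → r (p z)) , (λ z → q (s z))
          }
        ; reflexive = λ (p , q) → p
        ; trans = λ p q z → q (p z)
        }
      ; antisym = λ p q → p , q
      }

    Pˆ : Poset (lsuc 0ℓ) 0ℓ 0ℓ
    Pˆ = record { Carrier = Carrierˆ ; _≈_ = _≈ˆ_ ; _≤_ = _⊆ˆ_
                ; isPartialOrder = isPartialOrderˆ }

    η : Elt → Carrierˆ
    η a = U rk a , a , (λ z → z) , (λ z → z)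

    IsPosetIso : Set₁
    IsPosetIso = IsOrderIsomorphism _≡_ _≈ˆ_ _≼_ _⊆ˆ_ η

{-# OPTIONS --safe #-}
module Submission where

open import Defs
open import Data.Nat using (ℕ; _≤_; _<_; s≤s; z≤n; _≟_)
open import Data.Nat.Properties using (<-irrefl; <-≤-trans; suc-injective)
open import Data.Nat.Induction using (<-wellFounded)
open import Data.Fin using () renaming (_≟_ to _≟ᶠ_)
open import Data.Product using (Σ; _,_; proj₁; proj₂)
open import Data.Sum using (_⊎_; inj₁; inj₂; swap)
open import Data.Unit using (tt)
open import Data.Empty using (⊥-elim)
open import Data.List using (List; []; _∷_; _++_)
open import Data.List.Relation.Unary.Linked using (Linked; [-]; _∷_)
open import Data.List.Relation.Unary.AllPairs using ([]; _∷_)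
open import Data.List.Relation.Unary.All using ([])
open import Data.List.Relation.Unary.All.Properties using (¬Any⇒All¬)
open import Data.List.Relation.Unary.Any using (here; there)
open import Data.List.Relation.Unary.Unique.Propositional using (Unique)
open import Data.List.Membership.Propositional using (_∈_)
import Data.List.Membership.DecPropositional as DecMembership
open import Function.Base using (_on_)
open import Induction.WellFounded using (Acc; acc)
open import Level using (0ℓ)
open import Relation.Nullary using (yes; no)
open import Relation.Unary using (_⊆_)
open import Relation.Binary using (Rel; IsPartialOrder; _⇒_; DecidableEquality)
import Relation.Binary.Construct.On as On
open import Relation.Binary.Construct.Closure.ReflexiveTransitive using (Star; ε; _◅_)
open import Relation.Binary.PropositionalEquality using (_≡_; refl; sym; trans; subst)

-- The heart is that a common cover a of two elements x, y ≤ b lies below b.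
-- The graph F_{rk x} of the R-vine P_{≤b} is a tree, so x and y are joined in
-- it by a simple path.  A single edge E(v) forces v = a, as two elements of
-- equal rank have at most one common cover; a longer path, closed up by the
-- edge E(a), would be a cycle in the forest F_{rk x} of P.  Induction on rank
-- then turns U_a ⊆ U_b into a ≤ b, so η reflects the order; that η preserves
-- it and is onto is immediate.

module Walk {A : Set} {R : Rel A 0ℓ} where

  interior : ∀ {x y} → Star R x y → List A
  interior ε = []
  interior (_◅_ {j = v} _ w) = v ∷ interior w

  IsSimple : ∀ {x y} → Star R x y → Set
  IsSimple {x} w = Unique (x ∷ interior w)

  fromLinked : ∀ {x y} zs → Linked R (x ∷ zs ++ y ∷ []) → Star R x y
  fromLinked []       (e ∷ [-]) = e ◅ ε
  fromLinked (_ ∷ zs) (e ∷ es)  = e ◅ fromLinked zs es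

  closeLinked : ∀ {S : Rel A 0ℓ} {x y z} → R ⇒ S →
                (w : Star R x y) → S y z → Linked S (x ∷ interior w ++ z ∷ [])
  closeLinked f ε        e′ = e′ ∷ [-]
  closeLinked f (e ◅ w)  e′ = f e ∷ closeLinked f w e′

  simpleSuffix : ∀ {u v y} (w : Star R v y) → IsSimple w → u ∈ v ∷ interior w →
                 Σ (Star R u y) IsSimple
  simpleSuffix w       simple       (here refl) = w , simple
  simpleSuffix (_ ◅ w) (_ ∷ simple) (there u∈) = simpleSuffix w simple u∈

  toSimple : DecidableEquality A → ∀ {x y} → Star R x y → Σ (Star R x y) IsSimple
  toSimple _≟ᴬ_ ε = ε , [] ∷ []
  toSimple _≟ᴬ_ {x} (_◅_ {j = v} e w) with toSimple _≟ᴬ_ w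
  ... | w′ , simple with x ∈? v ∷ interior w′
    where open DecMembership _≟ᴬ_
  ...   | yes x∈ = simpleSuffix w′ simple x∈
  ...   | no  x∉ = e ◅ w′ , ¬Any⇒All¬ _ x∉ ∷ simple

module _ (P : FinPoset) (rk : FinPoset.Elt P → ℕ) where
  open FinPoset P
  open IsPartialOrder isPartialOrder using () renaming (refl to ≼-refl; trans to ≼-trans)
  module Whole = Sub P (Full P) rk
  module Below (b : Elt) = Sub P (Ideal P b) rk

  covers-below⇒covers : ∀ {b v c} → v ≼ b → Below.Covers b v c → Whole.Covers v c
  covers-below⇒covers v≼b (_ , _ , c≺v , between) =
    tt , tt , c≺v , λ z _ c≺z z≺v → between z (≼-trans (proj₁ z≺v) v≼b) c≺z z≺v

  covers⇒covers-below : ∀ {b v c} → v ≼ b → Whole.Covers v c → Below.Covers b v c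
  covers⇒covers-below v≼b (_ , _ , c≺v , between) =
    ≼-trans (proj₁ c≺v) v≼b , v≼b , c≺v , λ z _ → between z tt

  coversExactly-below⇒coversExactly : ∀ {b v x y} → v ≼ b →
    Below.CoversExactly b v x y → Whole.CoversExactly v x y
  coversExactly-below⇒coversExactly v≼b (x≢y , cx , cy , onlyXY) =
    x≢y , covers-below⇒covers v≼b cx , covers-below⇒covers v≼b cy ,
    λ c cc → onlyXY c (covers⇒covers-below v≼b cc)

  adj-below⇒adj : ∀ {b} i → Below.Adj b i ⇒ Whole.Adj i
  adj-below⇒adj i ((_ , rs) , (_ , rt) , v , v≼b , rv , exactly) =
    (tt , rs) , (tt , rt) , v , tt , rv , coversExactly-below⇒coversExactly v≼b exactly

  module _ (graded : Whole.IsGraded) where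
    private
      rk-positive = proj₁ graded
      rk-strictMono = proj₁ (proj₂ graded)
      rk-cover = proj₁ (proj₂ (proj₂ graded))

    rk≡1⇒minimal : ∀ {x} → rk x ≡ 1 → Whole.Minimal x
    rk≡1⇒minimal {x} rk≡1 = tt , below-is-equal
      where
      below-is-equal : ∀ y → _ → y ≼ x → y ≡ x
      below-is-equal y _ y≼x with y ≟ᶠ x
      ... | yes y≡x = y≡x
      ... | no  y≢x = ⊥-elim (<-irrefl refl
            (<-≤-trans (rk-strictMono y x tt tt (y≼x , y≢x))
                       (subst (_≤ rk y) (sym rk≡1) (rk-positive y tt))))

    covers⇒same-rk : ∀ {a x y} → Whole.Covers a x → Whole.Covers a y → rk x ≡ rk y
    covers⇒same-rk {a} {x} {y} ax ay = suc-injective (trans (sym (rk-cover x a ax)) (rk-cover y a ay))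

  module _ (lr : IsLRVine P rk) where
    private
      vine = proj₁ lr
      graded = proj₁ vine
      rk-strictMono = proj₁ (proj₂ graded)
      rk-cover = proj₁ (proj₂ (proj₂ graded))
      minimal⇒rk≡1 = proj₂ (proj₂ (proj₂ graded))
      twoCovered = proj₁ (proj₂ vine)
      uniqueCommonCover = proj₁ (proj₂ (proj₂ vine))
      forest = proj₂ (proj₂ (proj₂ vine))

    connected-below : ∀ {b x y} → x ≼ b → y ≼ b → rk x ≡ rk y →
                      Σ (Star (Below.Adj b (rk x)) x y) Walk.IsSimple
                      ⊎ x ≡ y
    connected-below {b} {x} {y} x≼b y≼b same-rk
      with proj₁ (proj₂ (proj₂ lr b))
    ... | m , (rk≤m , _) , _ , trees
      with proj₂ (trees (rk x) (proj₁ graded x tt) (rk≤m x x≼b)) x y (x≼b , refl) (y≼b , sym same-rk)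
    ... | inj₁ x≡y         = inj₂ x≡y
    ... | inj₂ (zs , path) = inj₁ (Walk.toSimple _≟ᶠ_ (Walk.fromLinked zs path))

    coversExactly-below : ∀ {a b x y} → Whole.CoversExactly a x y → x ≼ b → y ≼ b → a ≼ b
    coversExactly-below {a} {b} {x} {y} (x≢y , ax , ay , onlyXY) x≼b y≼b
      with connected-below x≼b y≼b (covers⇒same-rk graded ax ay)
    ... | inj₂ x≡y = ⊥-elim (x≢y x≡y)
    ... | inj₁ (w , simple) = viaSimplePath w simple
      where
      open Walk
      i = rk x
      same-rk = covers⇒same-rk graded ax ay
      closing : Whole.Adj i y x
      closing = (tt , sym same-rk) , (tt , refl) , a , tt , rk-cover x a ax ,
                (λ y≡x → x≢y (sym y≡x)) , ay , ax , λ c ac → swap (onlyXY c ac)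
      viaSimplePath : (w : Star (Below.Adj b i) x y) → IsSimple w → a ≼ b
      viaSimplePath ε _ = ⊥-elim (x≢y refl)
      viaSimplePath ((_ , _ , v , v≼b , _ , _ , vx , vy , _) ◅ ε) _ =
        subst (_≼ b) (uniqueCommonCover x y v a x≢y same-rk
                        (covers-below⇒covers v≼b vx) (covers-below⇒covers v≼b vy) ax ay) v≼b
      viaSimplePath w@(_ ◅ _ ◅ _) simple =
        ⊥-elim (forest i (x , interior w , s≤s (s≤s z≤n) , simple ,
                          closeLinked (adj-below⇒adj i) w closing))

    U-reflects-≼ : ∀ {a b} → U P rk a ⊆ U P rk b → a ≼ b
    U-reflects-≼ {a} = go (On.wellFounded rk <-wellFounded a)
      where
      go : ∀ {a b} → Acc (_<_ on rk) a → U P rk a ⊆ U P rk b → a ≼ b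
      go {a} {b} (acc below) Ua⊆Ub with rk a ≟ 1
      ... | yes rk≡1 = proj₂ (Ua⊆Ub (rk≡1⇒minimal graded rk≡1 , ≼-refl))
      ... | no  rk≢1 with twoCovered a tt (λ minimal → rk≢1 (minimal⇒rk≡1 a minimal))
      ...   | x , y , exactly@(_ , ax , ay , _) =
        coversExactly-below exactly (viaCover ax) (viaCover ay)
        where
        viaCover : ∀ {z} → Whole.Covers a z → z ≼ b
        viaCover (_ , _ , z≺a , _) =
          go (below (rk-strictMono _ a tt tt z≺a))
             (λ (minimal , m≼z) → Ua⊆Ub (minimal , ≼-trans m≼z (proj₁ z≺a)))

proposition4p8 : (P : FinPoset) (rk : FinPoset.Elt P → ℕ) → IsLRVine P rk → Hat.IsPosetIso P rk
proposition4p8 P rk lr = record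
  { isOrderMonomorphism = record
    { isOrderHomomorphism = record
      { cong = λ { refl → (λ m → m) , (λ m → m) }
      ; mono = λ a≼b (minimal , m≼a) → minimal , ≼-trans m≼a a≼b
      }
    ; injective = λ (Ua⊆Ub , Ub⊆Ua) → antisym (U-reflects-≼ P rk lr Ua⊆Ub) (U-reflects-≼ P rk lr Ub⊆Ua)
    ; cancel = U-reflects-≼ P rk lr
    }
  ; surjective = λ (V , a , V⊆Ua , Ua⊆V) → a , λ { refl → Ua⊆V , V⊆Ua }
  }
  where
  open FinPoset P
  open IsPartialOrder isPartialOrder using (antisym) renaming (trans to ≼-trans)
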